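{- Let $\ell$ be a prime, $q\ge1$ and $t\ge1$ integers. If the graph $N'(q,\ell)$ has a spanning forest in which every component tree has exactly $t$ vertices, then $\mathcal{E}(q,t\ell,\ell)\geq\frac{q^\ell-q}{t\ell}$, with equality if $q<t\ell$.
   Context: A $q$-ary necklace of length $\ell$ is an equivalence class of words in $\mathbb{Z}_q^\ell$ under cyclic rotation $a_1a_2\dots a_\ell\mapsto a_2\dots a_\ell a_1$; its size is the number of words in the class, and it is aperiodic if its size equals $\ell$. A word $f$ of length $r$ is a (cyclic) $r$-factor of a word $w$ if $f$ is the length-$r$ prefix of some cyclic rotation of $w$. $N'(q,\ell)$ is the simple undirected graph whose vertices are the aperiodic $q$-ary necklaces of length $\ell$, two necklaces being adjacent if some word of one and some word of the other share a common $(\ell-1)$-factor. For positive integers $q,k,\ell$ with $\ell\le k$: a colouring of $n$ eBugs is an $n$-tuple of words $w_1,\dots,w_n\in\mathbb{Z}_q^k$ (positions modulo $k$); it is $\ell$-valid if the $nk$ cyclic windows $(w_j(i),\dots,w_j(i+\ell-1))$, $1\le j\le n$, $0\le i<k$, are pairwise distinct; $\mathcal{E}(q,k,\ell)$ is the maximum $n$ for which an $\ell$-valid colouring of $n$ eBugs exists. -}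

module Defs where

open import Data.Nat using (ℕ; zero; suc; _+_; _∸_; _≤_; _%_)
open import Data.Nat.DivMod using (m%n<n)
open import Data.Fin as F using (Fin; toℕ; fromℕ<)
import Data.Fin.Properties as FP
open import Data.Vec as V using (Vec; []; _∷_; _∷ʳ_; lookup; toList)
open import Data.Vec.Properties using (≡-dec)
open import Data.List as L using (List; length; take; map; upTo; deduplicate)
open import Data.List.Membership.Propositional using (_∈_)
open import Data.List.Relation.Unary.Unique.Propositional using (Unique)
open import Data.Product using (Σ; ∃; ∃-syntax; _×_)
open import Relation.Nullary using (¬_)
open import Relation.Binary.PropositionalEquality using (_≡_; _≢_)
open import Relation.Binary.Construct.Closure.ReflexiveTransitive using (Star)
open import Function using (_⇔_)
open import Function.Definitions using (Injective)

Word : ℕ → ℕ → Set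
Word q ℓ = Vec (Fin q) ℓ

rot : ∀ {A : Set} {n} → Vec A n → Vec A n
rot []       = []
rot (x ∷ xs) = xs ∷ʳ x

rotN : ∀ {A : Set} {n} → ℕ → Vec A n → Vec A n
rotN zero    w = w
rotN (suc i) w = rotN i (rot w)

SameNecklace : ∀ {q ℓ} → Word q ℓ → Word q ℓ → Set
SameNecklace u v = ∃[ i ] rotN i u ≡ v

necklaceSize : ∀ {q ℓ} → Word q ℓ → ℕ
necklaceSize {q} {ℓ} w =
  length (deduplicate (≡-dec FP._≟_) (map (λ i → rotN i w) (upTo ℓ)))

Aperiodic : ∀ {q ℓ} → Word q ℓ → Set
Aperiodic {q} {ℓ} w = necklaceSize w ≡ ℓ

window : ∀ {A : Set} {n} → ℕ → ℕ → Vec A n → List A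
window r i w = take r (toList (rotN i w))

IsFactor : ∀ {q ℓ} → ℕ → List (Fin q) → Word q ℓ → Set
IsFactor r f w = ∃[ i ] window r i w ≡ f

-- The graph N'(q,ℓ), with vertex set given by an enumeration of the
-- aperiodic necklaces by representatives (one per necklace)

record NecklaceEnum {q ℓ m : ℕ} (reps : Vec (Word q ℓ) m) : Set where
  field
    aperiodic : ∀ i → Aperiodic (lookup reps i)
    distinct  : ∀ i j → SameNecklace (lookup reps i) (lookup reps j) → i ≡ j
    complete  : ∀ (w : Word q ℓ) → Aperiodic w → ∃[ i ] SameNecklace (lookup reps i) w

N'Adj : ∀ {q ℓ m} → Vec (Word q ℓ) m → Fin m → Fin m → Set
N'Adj {q} {ℓ} reps i j =
  i ≢ j ×
  ∃[ u ] ∃[ v ] (SameNecklace (lookup reps i) u × SameNecklace (lookup reps j) v ×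
                 ∃[ f ] (IsFactor (ℓ ∸ 1) f u × IsFactor (ℓ ∸ 1) f v))

next : ∀ {n} → Fin (suc n) → Fin (suc n)
next {n} i = fromℕ< (m%n<n (suc (toℕ i)) (suc n))

Acyclic : ∀ {m} → (Fin m → Fin m → Set) → Set
Acyclic {m} F =
  ∀ c (f : Fin (3 + c) → Fin m) → Injective _≡_ _≡_ f → ¬ (∀ i → F (f i) (f (next i)))

ComponentSize : ∀ {m} → (Fin m → Fin m → Set) → Fin m → ℕ → Set
ComponentSize {m} F u t =
  ∃[ xs ] (length xs ≡ t × Unique xs × (∀ (v : Fin m) → (v ∈ xs ⇔ Star F u v)))

record SpanningForestOfSize {m : ℕ} (Adj : Fin m → Fin m → Set) (t : ℕ) : Set₁ where
  field
    F          : Fin m → Fin m → Set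
    subgraph   : ∀ i j → F i j → Adj i j
    symmetric  : ∀ i j → F i j → F j i
    acyclic    : Acyclic F
    treeSizes  : ∀ u → ComponentSize F u t

Valid : ∀ {q k n} → ℕ → Vec (Word q k) n → Set
Valid {q} {k} {n} ℓ ws =
  ∀ (j j' : Fin n) (i i' : Fin k) →
    window ℓ (toℕ i) (lookup ws j) ≡ window ℓ (toℕ i') (lookup ws j') →
    j ≡ j' × i ≡ i'

Is𝓔 : ℕ → ℕ → ℕ → ℕ → Set
Is𝓔 q k ℓ E =
  Σ (Vec (Word q k) E) (Valid ℓ) ×
  (∀ n (ws : Vec (Word q k) n) → Valid ℓ ws → n ≤ E)

module Submission where

-- For prime ℓ a word is aperiodic iff it is non-constant, so the aperiodic necklaces hold
-- exactly the q^ℓ − q non-constant words, each necklace being the ℓ cyclic ℓ-windows of any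
-- of its words. If two necklaces share an (ℓ−1)-factor f, rotating a word of each to start
-- with f and concatenating gives a cyclic word whose ℓ-windows are those of both necklaces.
-- Gluing the necklaces of a tree of the forest edge by edge thus yields one eBug of length
-- tℓ, and the N trees yield a valid colouring whose N·tℓ windows are all non-constant words:
-- N·tℓ = q^ℓ − q. Conversely the windows of a valid colouring by E bugs are E·tℓ distinct
-- words, so E·tℓ ≤ q^ℓ = N·tℓ + q, which forces E = N when q < tℓ.

open import Defs
open import Data.Nat using (ℕ; zero; suc; _+_; _*_; _∸_; _^_; _≤_; _<_; z≤n; s≤s; s≤s⁻¹; _⊓_)
open import Data.Nat.Properties
open import Data.Nat.Primality using (Prime; ¬prime[0]; ¬prime[1])
open import Data.Nat.Coprimality using (prime⇒coprime; coprime-Bézout)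
open import Data.Nat.GCD using (module Bézout)
open import Data.Fin as Fin using (Fin)
import Data.Fin.Properties as FP
open import Data.Vec as V using (Vec; []; _∷_; toList)
import Data.Vec.Properties as VP
open import Data.List as L
  using (List; []; _∷_; _++_; [_]; take; drop; length; applyUpTo; deduplicate; concatMap)
import Data.List.Properties as LP
open import Data.List.Membership.Propositional using (_∈_; _∉_; find; lose)
open import Data.List.Membership.Propositional.Properties
  using (∈-applyUpTo⁺; ∈-applyUpTo⁻; ∈-deduplicate⁺; ∈-map⁻; ∈-lookup; ∈-++⁻; ∈-++⁺ˡ; ∈-++⁺ʳ;
         ∈-concatMap⁺; ∈-concatMap⁻; ∈-allFin)
open import Data.List.Membership.Setoid.Properties using (index-injective)
open import Data.List.Relation.Unary.Any as Any using (here; there)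
open import Data.List.Relation.Unary.All as All using (All; [])
open import Data.List.Relation.Unary.All.Properties using (all-filter; ¬All⇒Any¬)
open import Data.List.Relation.Unary.AllPairs using ([]; _∷_)
open import Data.List.Relation.Unary.Unique.Propositional using (Unique)
import Data.List.Relation.Unary.Unique.Propositional.Properties as UP
open import Data.List.Relation.Binary.Disjoint.Propositional using (Disjoint)
open import Data.List.Relation.Binary.Permutation.Propositional as Perm
  using (_↭_; ↭-refl; ↭-sym; ↭-trans; ↭-reflexive)
open import Data.List.Relation.Binary.Permutation.Propositional.Properties
  using (∷↭∷ʳ; ∈-resp-↭; ++⁺; ↭-length)
import Data.List.Relation.Binary.Permutation.Setoid.Properties as PermSetoid
open import Data.Product using (Σ; ∃; ∃-syntax; _×_; _,_; proj₁; proj₂; uncurry)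
open import Data.Product.Function.NonDependent.Propositional using (_×-↔_)
open import Data.Sum using (_⊎_; inj₁; inj₂)
open import Data.Sum.Properties using (inj₁-injective; inj₂-injective)
open import Data.Empty using (⊥-elim)
open import Function using (_∘_; case_of_)
open import Function.Bundles using (_↔_; _↣_; _⇔_; Injection; Equivalence; mk↔ₛ′; mk↣; mk⇔)
open import Function.Definitions using (Injective)
open import Function.Properties.Inverse using (↔-refl; ↔-sym; ↔-trans; ↔⇒↣)
open import Function.Properties.Injection using (↣-trans)
open import Relation.Nullary using (¬_; ¬?; Dec; yes; no)
open import Relation.Binary.Definitions using (DecidableEquality)
open import Relation.Binary.Construct.Closure.ReflexiveTransitive using (Star; ε; _◅_; _◅◅_; reverse)
import Relation.Binary.PropositionalEquality as ≡
open import Relation.Binary.PropositionalEquality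
  using (_≡_; _≢_; refl; sym; trans; cong; cong₂; subst; module ≡-Reasoning)

private variable
  A : Set

applyUpTo-cong : ∀ {f g : ℕ → A} n → (∀ {i} → i < n → f i ≡ g i) →
                 applyUpTo f n ≡ applyUpTo g n
applyUpTo-cong zero    f≗g = refl
applyUpTo-cong (suc n) f≗g = cong₂ _∷_ (f≗g (s≤s z≤n)) (applyUpTo-cong n (f≗g ∘ s≤s))

applyUpTo-+ : ∀ (f : ℕ → A) m n →
              applyUpTo f (m + n) ≡ applyUpTo f m ++ applyUpTo (f ∘ (m +_)) n
applyUpTo-+ f zero    n = refl
applyUpTo-+ f (suc m) n = cong (f 0 ∷_) (applyUpTo-+ (f ∘ suc) m n)

applyUpTo-suc-↭ : ∀ (f : ℕ → A) n → f n ≡ f 0 → applyUpTo (f ∘ suc) n ↭ applyUpTo f n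
applyUpTo-suc-↭ f zero    _     = ↭-refl
applyUpTo-suc-↭ f (suc n) fn≡f0 = begin
  applyUpTo (f ∘ suc) (suc n)            ≡⟨ LP.applyUpTo-∷ʳ (f ∘ suc) n ⟨
  applyUpTo (f ∘ suc) n L.∷ʳ f (suc n)   ↭⟨ ↭-sym (∷↭∷ʳ (f (suc n)) _) ⟩
  f (suc n) ∷ applyUpTo (f ∘ suc) n      ≡⟨ cong (_∷ applyUpTo (f ∘ suc) n) fn≡f0 ⟩
  applyUpTo f (suc n)                    ∎
  where open Perm.PermutationReasoning

applyUpTo-injective : ∀ {f : ℕ → A} n → Unique (applyUpTo f n) →
                      ∀ {i j} → i < n → j < n → f i ≡ f j → i ≡ j
applyUpTo-injective (suc n) _ {zero} {zero} _ _ _ = refl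
applyUpTo-injective (suc n) (f0∉ ∷ _) {zero} {suc j} _ (s≤s j<n) f0≡fj =
  ⊥-elim (All.lookup f0∉ (∈-applyUpTo⁺ _ j<n) f0≡fj)
applyUpTo-injective (suc n) (f0∉ ∷ _) {suc i} {zero} (s≤s i<n) _ fi≡f0 =
  ⊥-elim (All.lookup f0∉ (∈-applyUpTo⁺ _ i<n) (sym fi≡f0))
applyUpTo-injective (suc n) (_ ∷ u) {suc i} {suc j} (s≤s i<n) (s≤s j<n) fi≡fj =
  cong suc (applyUpTo-injective n u i<n j<n fi≡fj)

take-++ : ∀ n (xs ys : List A) → take n (xs ++ ys) ≡ take n xs ++ take (n ∸ length xs) ys
take-++ zero    []       ys = refl
take-++ (suc n) []       ys = refl
take-++ zero    (x ∷ xs) ys = refl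
take-++ (suc n) (x ∷ xs) ys = cong (x ∷_) (take-++ n xs ys)

take-++-≤ : ∀ {n} (xs ys : List A) → n ≤ length xs → take n (xs ++ ys) ≡ take n xs
take-++-≤ {n = n} xs ys n≤xs = begin
  take n (xs ++ ys)                           ≡⟨ take-++ n xs ys ⟩
  take n xs ++ take (n ∸ length xs) ys        ≡⟨ cong (λ k → take n xs ++ take k ys) (m≤n⇒m∸n≡0 n≤xs) ⟩
  take n xs ++ []                             ≡⟨ LP.++-identityʳ (take n xs) ⟩
  take n xs                                   ∎
  where open ≡-Reasoning

take-take-≤ : ∀ {m n} (xs : List A) → m ≤ n → take m (take n xs) ≡ take m xs
take-take-≤ {m = m} {n} xs m≤n = trans (LP.take-take m n xs) (cong (λ k → take k xs) (m≤n⇒m⊓n≡m m≤n))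

Unique-resp-↭ : ∀ {xs ys : List A} → xs ↭ ys → Unique xs → Unique ys
Unique-resp-↭ p = PermSetoid.Unique-resp-↭ (≡.setoid _) (Perm.↭⇒↭ₛ p)

Unique-++⁻ : ∀ xs {ys : List A} → Unique (xs ++ ys) → Unique xs × Unique ys × Disjoint xs ys
Unique-++⁻ []       u          = [] , u , λ ()
Unique-++⁻ (x ∷ xs) (x∉ ∷ u) with Unique-++⁻ xs u
... | xs-unique , ys-unique , disjoint =
  All.tabulate (λ y∈xs → All.lookup x∉ (∈-++⁺ˡ y∈xs)) ∷ xs-unique , ys-unique ,
  λ { (here refl , x∈ys) → All.lookup x∉ (∈-++⁺ʳ xs x∈ys) refl
    ; (there y∈xs , y∈ys) → disjoint (y∈xs , y∈ys) }

lookup-injective : ∀ {xs : List A} → Unique xs → ∀ {i j} → L.lookup xs i ≡ L.lookup xs j → i ≡ j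
lookup-injective (_  ∷ _) {Fin.zero}  {Fin.zero}  _  = refl
lookup-injective (x∉ ∷ _) {Fin.zero}  {Fin.suc j} eq = ⊥-elim (All.lookup x∉ (∈-lookup j) eq)
lookup-injective (x∉ ∷ _) {Fin.suc i} {Fin.zero}  eq = ⊥-elim (All.lookup x∉ (∈-lookup i) (sym eq))
lookup-injective (_  ∷ u) {Fin.suc i} {Fin.suc j} eq = cong Fin.suc (lookup-injective u eq)

Unique-⊆⇒length≤ : ∀ {xs ys : List A} → Unique xs → (∀ {x} → x ∈ xs → x ∈ ys) →
                   length xs ≤ length ys
Unique-⊆⇒length≤ unique xs⊆ys = FP.injective⇒≤ {f = λ i → Any.index (xs⊆ys (∈-lookup i))}
  (λ eq → lookup-injective unique (index-injective (≡.setoid _) _ _ eq))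

module _ (_≟_ : DecidableEquality A) where

  deduplicate-Unique : ∀ {xs} → Unique xs → deduplicate _≟_ xs ≡ xs
  deduplicate-Unique {[]}     []        = refl
  deduplicate-Unique {x ∷ xs} (x∉ ∷ u) rewrite deduplicate-Unique u =
    cong (x ∷_) (LP.filter-all (¬? ∘ (x ≟_)) x∉)

  length-deduplicate⇒Unique : ∀ xs → length (deduplicate _≟_ xs) ≡ length xs → Unique xs
  length-deduplicate⇒Unique []       _  = []
  length-deduplicate⇒Unique (x ∷ xs) eq =
    All.tabulate (λ y∈xs → All.lookup x∉D (∈-deduplicate⁺ _≟_ y∈xs)) ∷
    length-deduplicate⇒Unique xs |D|≡|xs|
    where
    D = deduplicate _≟_ xs
    |F|≤|D| = LP.length-filter (¬? ∘ (x ≟_)) D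
    |D|≡|xs| : length D ≡ length xs
    |D|≡|xs| = ≤-antisym (LP.length-deduplicate _≟_ xs)
                         (≤-trans (≤-reflexive (sym (suc-injective eq))) |F|≤|D|)
    x∉D : All (x ≢_) D
    x∉D = subst (All (x ≢_))
            (LP.filter-complete (¬? ∘ (x ≟_)) (trans (suc-injective eq) (sym |D|≡|xs|)))
            (all-filter (¬? ∘ (x ≟_)) D)

fromList′ : ∀ {n} (xs : List A) → length xs ≡ n → Vec A n
fromList′ xs eq = V.cast eq (V.fromList xs)

toList-fromList′ : ∀ {n} (xs : List A) (eq : length xs ≡ n) → toList (fromList′ xs eq) ≡ xs
toList-fromList′ xs eq = trans (VP.toList-cast eq (V.fromList xs)) (VP.toList∘fromList xs)

lrot : List A → List A
lrot []       = []
lrot (x ∷ xs) = xs ++ [ x ]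

lrotN : ℕ → List A → List A
lrotN zero    xs = xs
lrotN (suc i) xs = lrotN i (lrot xs)

length-lrot : (xs : List A) → length (lrot xs) ≡ length xs
length-lrot []       = refl
length-lrot (x ∷ xs) = trans (LP.length-++ xs) (+-comm (length xs) 1)

length-lrotN : ∀ i (xs : List A) → length (lrotN i xs) ≡ length xs
length-lrotN zero    xs = refl
length-lrotN (suc i) xs = trans (length-lrotN i (lrot xs)) (length-lrot xs)

lrotN-+ : ∀ i j (xs : List A) → lrotN (i + j) xs ≡ lrotN j (lrotN i xs)
lrotN-+ zero    j xs = refl
lrotN-+ (suc i) j xs = lrotN-+ i j (lrot xs)

lrotN-++ : ∀ i (u w : List A) → i ≤ length u →
           lrotN i (u ++ w) ≡ drop i u ++ w ++ take i u
lrotN-++ zero    u       w _         = cong (u ++_) (sym (LP.++-identityʳ w))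
lrotN-++ (suc i) (x ∷ u) w (s≤s i≤u) = begin
  lrotN i ((u ++ w) ++ [ x ])          ≡⟨ cong (lrotN i) (LP.++-assoc u w [ x ]) ⟩
  lrotN i (u ++ w ++ [ x ])            ≡⟨ lrotN-++ i u (w ++ [ x ]) i≤u ⟩
  drop i u ++ (w ++ [ x ]) ++ take i u ≡⟨ cong (drop i u ++_) (LP.++-assoc w [ x ] (take i u)) ⟩
  drop i u ++ w ++ x ∷ take i u        ∎
  where open ≡-Reasoning

lrotN-length-++ : (u w : List A) → lrotN (length u) (u ++ w) ≡ w ++ u
lrotN-length-++ u w = begin
  lrotN (length u) (u ++ w)                   ≡⟨ lrotN-++ (length u) u w ≤-refl ⟩
  drop (length u) u ++ w ++ take (length u) u ≡⟨ cong₂ (λ d t → d ++ w ++ t)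
                                                   (LP.drop-all (length u) u ≤-refl)
                                                   (LP.take-all (length u) u ≤-refl) ⟩
  w ++ u                                      ∎
  where open ≡-Reasoning

lrotN-length : (xs : List A) → lrotN (length xs) xs ≡ xs
lrotN-length xs = trans (cong (lrotN (length xs)) (sym (LP.++-identityʳ xs)))
                        (lrotN-length-++ xs [])

module CyclicWindows (L : ℕ) where

  lwindow : ℕ → List A → List A
  lwindow i xs = take L (lrotN i xs)

  windows : List A → List (List A)
  windows xs = applyUpTo (λ i → lwindow i xs) (length xs)

  length-windows : (xs : List A) → length (windows xs) ≡ length xs
  length-windows xs = LP.length-applyUpTo _ (length xs)

  windows-lrot : (xs : List A) → windows (lrot xs) ↭ windows xs
  windows-lrot []       = ↭-refl
  windows-lrot (x ∷ xs) rewrite length-lrot (x ∷ xs) =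
    applyUpTo-suc-↭ (λ i → lwindow i (x ∷ xs)) (suc (length xs))
      (cong (take L) (lrotN-length (x ∷ xs)))

  windows-lrotN : ∀ i (xs : List A) → windows (lrotN i xs) ↭ windows xs
  windows-lrotN zero    xs = ↭-refl
  windows-lrotN (suc i) xs = ↭-trans (windows-lrotN i (lrot xs)) (windows-lrot xs)

  lwindow-zero-∈-windows : (xs : List A) → 0 < length xs → lwindow 0 xs ∈ windows xs
  lwindow-zero-∈-windows (x ∷ xs) _ = here refl

  lwindow-∈-windows : ∀ i (xs : List A) → 0 < length xs → lwindow i xs ∈ windows xs
  lwindow-∈-windows i xs xs≢[] = ∈-resp-↭ (windows-lrotN i xs)
    (lwindow-zero-∈-windows (lrotN i xs) (subst (0 <_) (sym (length-lrotN i xs)) xs≢[]))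

  lwindow-++ : ∀ {i} (u v : List A) → i < length u → L ≤ length u → L ≤ length v →
               take (L ∸ 1) u ≡ take (L ∸ 1) v → lwindow i (u ++ v) ≡ lwindow i u
  lwindow-++ {i = i} u v i<u L≤u L≤v prefixes = begin
    take L (lrotN i (u ++ v))                   ≡⟨ cong (take L) (lrotN-++ i u v (<⇒≤ i<u)) ⟩
    take L (drop i u ++ v ++ take i u)          ≡⟨ take-++ L (drop i u) _ ⟩
    take L (drop i u) ++ take c (v ++ take i u) ≡⟨ cong (take L (drop i u) ++_) wrap ⟩
    take L (drop i u) ++ take c (take i u)      ≡⟨ take-++ L (drop i u) _ ⟨
    take L (drop i u ++ take i u)               ≡⟨ cong (take L) (lrotN-++ i u [] (<⇒≤ i<u)) ⟨
    take L (lrotN i (u ++ []))                  ≡⟨ cong (λ z → take L (lrotN i z)) (LP.++-identityʳ u) ⟩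
    take L (lrotN i u)                          ∎
    where
    open ≡-Reasoning
    -- c letters of the window wrap around past the end of u; c < L, so they lie in the shared prefix.
    c = L ∸ length (drop i u)
    d≡ : length (drop i u) ≡ length u ∸ i
    d≡ = LP.length-drop i u
    c≤i : c ≤ i
    c≤i = ≤-trans (∸-monoˡ-≤ (length (drop i u)) L≤u)
                  (≤-reflexive (trans (cong (length u ∸_) d≡) (m∸[m∸n]≡n (<⇒≤ i<u))))
    c≤L∸1 : c ≤ L ∸ 1
    c≤L∸1 = ∸-monoʳ-≤ L (subst (1 ≤_) (sym d≡) (m<n⇒0<n∸m i<u))
    wrap : take c (v ++ take i u) ≡ take c (take i u)
    wrap = begin
      take c (v ++ take i u)  ≡⟨ take-++-≤ v (take i u) (≤-trans (m∸n≤m L (length (drop i u))) L≤v) ⟩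
      take c v                ≡⟨ take-take-≤ v c≤L∸1 ⟨
      take c (take (L ∸ 1) v) ≡⟨ cong (take c) prefixes ⟨
      take c (take (L ∸ 1) u) ≡⟨ take-take-≤ u c≤L∸1 ⟩
      take c u                ≡⟨ take-take-≤ u c≤i ⟨
      take c (take i u)       ∎

  windows-++ : (u v : List A) → L ≤ length u → L ≤ length v →
               take (L ∸ 1) u ≡ take (L ∸ 1) v → windows (u ++ v) ≡ windows u ++ windows v
  windows-++ u v L≤u L≤v prefixes = begin
    applyUpTo (λ i → lwindow i (u ++ v)) (length (u ++ v))
      ≡⟨ cong (applyUpTo _) (LP.length-++ u) ⟩
    applyUpTo (λ i → lwindow i (u ++ v)) (length u + length v)
      ≡⟨ applyUpTo-+ _ (length u) (length v) ⟩
    applyUpTo (λ i → lwindow i (u ++ v)) (length u) ++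
    applyUpTo (λ i → lwindow (length u + i) (u ++ v)) (length v)
      ≡⟨ cong₂ _++_ (applyUpTo-cong (length u) (λ i<u → lwindow-++ u v i<u L≤u L≤v prefixes))
                    (applyUpTo-cong (length v) (λ {i} i<v → trans
                       (cong (take L) (trans (lrotN-+ (length u) i (u ++ v))
                                             (cong (lrotN i) (lrotN-length-++ u v))))
                       (lwindow-++ v u i<v L≤v L≤u (sym prefixes)))) ⟩
    windows u ++ windows v
      ∎
    where open ≡-Reasoning

open CyclicWindows

toList-rotN : ∀ {n} i (w : Vec A n) → toList (rotN i w) ≡ lrotN i (toList w)
toList-rotN zero    w       = refl
toList-rotN (suc i) []      = toList-rotN i []
toList-rotN (suc i) (x ∷ w) = trans (toList-rotN i (w V.∷ʳ x)) (cong (lrotN i) (VP.toList-∷ʳ x w))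

rotN-+ : ∀ {n} i j (w : Vec A n) → rotN (i + j) w ≡ rotN j (rotN i w)
rotN-+ zero    j w = refl
rotN-+ (suc i) j w = rotN-+ i j (rot w)

rotN-comm : ∀ {n} i j (w : Vec A n) → rotN i (rotN j w) ≡ rotN j (rotN i w)
rotN-comm i j w = trans (sym (rotN-+ j i w)) (trans (cong (λ k → rotN k w) (+-comm j i)) (rotN-+ i j w))

toList-injective : ∀ {n} {v w : Vec A n} → toList v ≡ toList w → v ≡ w
toList-injective {v = v} {w} eq = trans (sym (VP.cast-is-id refl v)) (VP.toList-injective refl v w eq)

rotN-length : ∀ {n} (w : Vec A n) → rotN n w ≡ w
rotN-length {n = n} w = toList-injective (begin
  toList (rotN n w)                   ≡⟨ toList-rotN n w ⟩
  lrotN n (toList w)                  ≡⟨ cong (λ k → lrotN k (toList w)) (VP.length-toList w) ⟨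
  lrotN (length (toList w)) (toList w) ≡⟨ lrotN-length (toList w) ⟩
  toList w                            ∎)
  where open ≡-Reasoning

rotN-periodic : ∀ {n} d (w : Vec A n) → rotN d w ≡ w → ∀ c → rotN (c * d) w ≡ w
rotN-periodic d w d-period zero    = refl
rotN-periodic d w d-period (suc c) =
  trans (rotN-+ d (c * d) w) (trans (cong (rotN (c * d)) d-period) (rotN-periodic d w d-period c))

rotN-inverse : ∀ {n} c (w : Vec A (suc n)) → rotN (c * n) (rotN c w) ≡ w
rotN-inverse {n = n} c w = begin
  rotN (c * n) (rotN c w) ≡⟨ rotN-+ c (c * n) w ⟨
  rotN (c + c * n) w      ≡⟨ cong (λ k → rotN k w) (*-suc c n) ⟨
  rotN (c * suc n) w      ≡⟨ rotN-periodic (suc n) w (rotN-length w) c ⟩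
  w                       ∎
  where open ≡-Reasoning

rotations : ∀ {n} → Vec A n → List (Vec A n)
rotations {n = n} w = L.map (λ i → rotN i w) (L.upTo n)

window≡lwindow : ∀ {n} ℓ i (w : Vec A n) → window ℓ i w ≡ lwindow ℓ i (toList w)
window≡lwindow ℓ i w = cong (take ℓ) (toList-rotN i w)

lwindow-toList : ∀ {n} i (w : Vec A n) → lwindow n i (toList w) ≡ toList (rotN i w)
lwindow-toList {n = n} i w = trans (sym (window≡lwindow n i w))
  (LP.take-all n _ (≤-reflexive (VP.length-toList (rotN i w))))

windows-toList : ∀ {n} (w : Vec A n) → windows n (toList w) ≡ L.map toList (rotations w)
windows-toList {n = n} w = begin
  applyUpTo (λ i → lwindow n i (toList w)) (length (toList w))
    ≡⟨ cong (applyUpTo _) (VP.length-toList w) ⟩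
  applyUpTo (λ i → lwindow n i (toList w)) n
    ≡⟨ applyUpTo-cong n (λ {i} _ → lwindow-toList i w) ⟩
  applyUpTo (λ i → toList (rotN i w)) n
    ≡⟨ LP.map-upTo _ n ⟨
  L.map (λ i → toList (rotN i w)) (L.upTo n)
    ≡⟨ LP.map-∘ (L.upTo n) ⟩
  L.map toList (rotations w)
    ∎
  where open ≡-Reasoning

∈-windows-toList⁻ : ∀ {n x} (w : Vec A n) → x ∈ windows n (toList w) → ∃[ c ] x ≡ toList (rotN c w)
∈-windows-toList⁻ w x∈ with ∈-map⁻ toList (subst (_ ∈_) (windows-toList w) x∈)
... | _ , v∈ , refl with ∈-map⁻ _ v∈
...   | c , _ , refl = c , refl

module _ {q ℓ : ℕ} where

  Aperiodic⇒Unique-rotations : (w : Word q ℓ) → Aperiodic w → Unique (rotations w)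
  Aperiodic⇒Unique-rotations w aperiodic =
    length-deduplicate⇒Unique (VP.≡-dec FP._≟_) (rotations w)
      (trans aperiodic (sym (trans (LP.length-map _ (L.upTo ℓ)) (LP.length-upTo ℓ))))

  Unique-rotations⇒Aperiodic : (w : Word q ℓ) → Unique (rotations w) → Aperiodic w
  Unique-rotations⇒Aperiodic w unique = begin
    length (deduplicate (VP.≡-dec FP._≟_) (rotations w)) ≡⟨ cong length (deduplicate-Unique _ unique) ⟩
    length (rotations w)                                 ≡⟨ LP.length-map _ (L.upTo ℓ) ⟩
    length (L.upTo ℓ)                                    ≡⟨ LP.length-upTo ℓ ⟩
    ℓ                                                    ∎
    where open ≡-Reasoning

  Aperiodic⇒Unique-windows : (w : Word q ℓ) → Aperiodic w → Unique (windows ℓ (toList w))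
  Aperiodic⇒Unique-windows w aperiodic = subst Unique (sym (windows-toList w))
    (UP.map⁺ toList-injective (Aperiodic⇒Unique-rotations w aperiodic))

-- Stated as invariance under rotation; Constant⇒replicate recovers the usual meaning.
Constant : ∀ {n} → Vec A n → Set
Constant w = rot w ≡ w

Constant-rotN⁻ : ∀ {n} c (w : Vec A n) → Constant (rotN c w) → Constant w
Constant-rotN⁻ c []                   _                = refl
Constant-rotN⁻ {n = suc n} c w@(_ ∷ _) rotated-constant = begin
  rot w                          ≡⟨ cong rot (rotN-inverse c w) ⟨
  rot (rotN (c * n) (rotN c w))  ≡⟨ rotN-comm 1 (c * n) (rotN c w) ⟩
  rotN (c * n) (rot (rotN c w))  ≡⟨ cong (rotN (c * n)) rotated-constant ⟩
  rotN (c * n) (rotN c w)        ≡⟨ rotN-inverse c w ⟩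
  w                              ∎
  where open ≡-Reasoning

replicate-Constant : ∀ n (x : A) → Constant (V.replicate n x)
replicate-Constant zero          x = refl
replicate-Constant (suc zero)    x = refl
replicate-Constant (suc (suc n)) x = cong (x ∷_) (replicate-Constant (suc n) x)

∷ʳ≡∷⇒replicate : ∀ {n} (x : A) (w : Vec A n) → w V.∷ʳ x ≡ x ∷ w → w ≡ V.replicate n x
∷ʳ≡∷⇒replicate x []      _  = refl
∷ʳ≡∷⇒replicate x (y ∷ w) eq with VP.∷-injective eq
... | refl , eq′ = cong (y ∷_) (∷ʳ≡∷⇒replicate x w eq′)

Constant⇒replicate : ∀ {n} (w : Vec A (suc n)) → Constant w → w ≡ V.replicate (suc n) (V.head w)
Constant⇒replicate (x ∷ w) constant = cong (x ∷_) (∷ʳ≡∷⇒replicate x w constant)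

module _ {q : ℕ} where

  Aperiodic⇒¬Constant : ∀ {n} (w : Word q (suc (suc n))) → Aperiodic w → ¬ Constant w
  Aperiodic⇒¬Constant w aperiodic constant with Aperiodic⇒Unique-rotations w aperiodic
  ... | w∉rest ∷ _ = All.head w∉rest (sym constant)

  module _ {ℓ : ℕ} (ℓ-prime : Prime ℓ) where

    -- Bézout: 1 + z d = x ℓ or 1 + x ℓ = z d, so a d-periodic word is 1-periodic.
    periodic⇒Constant : ∀ {d} → 0 < d → d < ℓ → (w : Vec A ℓ) → rotN d w ≡ w → Constant w
    periodic⇒Constant {d = d@(suc _)} _ d<ℓ w d-period
      with coprime-Bézout (prime⇒coprime ℓ-prime d<ℓ)
    ... | Bézout.+- x z 1+zd≡xℓ = begin
      rot w                ≡⟨ cong rot (rotN-periodic d w d-period z) ⟨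
      rot (rotN (z * d) w) ≡⟨ rotN-comm 1 (z * d) w ⟩
      rotN (1 + z * d) w   ≡⟨ cong (λ k → rotN k w) 1+zd≡xℓ ⟩
      rotN (x * ℓ) w       ≡⟨ rotN-periodic ℓ w (rotN-length w) x ⟩
      w                    ∎
      where open ≡-Reasoning
    ... | Bézout.-+ x z 1+xℓ≡zd = begin
      rot w                ≡⟨ cong rot (rotN-periodic ℓ w (rotN-length w) x) ⟨
      rot (rotN (x * ℓ) w) ≡⟨ rotN-comm 1 (x * ℓ) w ⟩
      rotN (1 + x * ℓ) w   ≡⟨ cong (λ k → rotN k w) 1+xℓ≡zd ⟩
      rotN (z * d) w       ≡⟨ rotN-periodic d w d-period z ⟩
      w                    ∎
      where open ≡-Reasoning

    ¬Constant⇒Aperiodic : (w : Word q ℓ) → ¬ Constant w → Aperiodic w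
    ¬Constant⇒Aperiodic w nonconstant = Unique-rotations⇒Aperiodic w
      (subst Unique (sym (LP.map-upTo _ ℓ)) (UP.applyUpTo⁺₁ _ ℓ rotations-distinct))
      where
      rotations-distinct : ∀ {i j} → i < j → j < ℓ → rotN i w ≢ rotN j w
      rotations-distinct {i} {j} i<j j<ℓ rᵢ≡rⱼ = nonconstant (Constant-rotN⁻ i w
        (periodic⇒Constant (m<n⇒0<n∸m i<j) (≤-<-trans (m∸n≤m j i) j<ℓ) (rotN i w) (begin
          rotN (j ∸ i) (rotN i w) ≡⟨ rotN-+ i (j ∸ i) w ⟨
          rotN (i + (j ∸ i)) w    ≡⟨ cong (λ k → rotN k w) (m+[n∸m]≡n (<⇒≤ i<j)) ⟩
          rotN j w                ≡⟨ rᵢ≡rⱼ ⟨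
          rotN i w                ∎)))
        where open ≡-Reasoning

rotN≡⇒SameNecklace : ∀ {q n} c c′ (x x′ : Word q (suc n)) → rotN c x ≡ rotN c′ x′ → SameNecklace x x′
rotN≡⇒SameNecklace {n = n} c c′ x x′ eq = c + c′ * n , (begin
  rotN (c + c′ * n) x          ≡⟨ rotN-+ c (c′ * n) x ⟩
  rotN (c′ * n) (rotN c x)     ≡⟨ cong (rotN (c′ * n)) eq ⟩
  rotN (c′ * n) (rotN c′ x′)   ≡⟨ rotN-inverse c′ x′ ⟩
  x′                           ∎)
  where open ≡-Reasoning

injection⇒≤ : ∀ {B : Set} {m n} → A ↔ Fin m → B ↔ Fin n → A ↣ B → m ≤ n
injection⇒≤ A↔m B↔n A↣B =
  FP.injective⇒≤ (Injection.injective (↣-trans (↔⇒↣ (↔-sym A↔m)) (↣-trans A↣B (↔⇒↣ B↔n))))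

Vec↔Fin^ : ∀ q n → Vec (Fin q) n ↔ Fin (q ^ n)
Vec↔Fin^ q zero    =
  mk↔ₛ′ (λ _ → Fin.zero) (λ _ → []) (λ { Fin.zero → refl ; (Fin.suc ()) }) (λ { [] → refl })
Vec↔Fin^ q (suc n) = ↔-trans uncons↔ (↔-trans (↔-refl ×-↔ Vec↔Fin^ q n) (↔-sym FP.*↔×))
  where
  uncons↔ : Vec (Fin q) (suc n) ↔ (Fin q × Vec (Fin q) n)
  uncons↔ = mk↔ₛ′ V.uncons (uncurry _∷_) (λ _ → refl) (λ { (_ ∷ _) → refl })

length≡#nonConstant : ∀ {q n} (C : List (List (Fin q))) → Unique C →
  (∀ {x} → x ∈ C → Σ (Word q (suc n)) λ w → x ≡ toList w × ¬ Constant w) →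
  (∀ (w : Word q (suc n)) → ¬ Constant w → toList w ∈ C) →
  length C + q ≡ q ^ suc n
length≡#nonConstant {q} {n} C unique sound complete = ≤-antisym
  (injection⇒≤ Code↔ (Vec↔Fin^ q (suc n)) (mk↣ decode-injective))
  (injection⇒≤ (Vec↔Fin^ q (suc n)) Code↔ (mk↣ encode-injective))
  where
  Code = Fin (length C) ⊎ Fin q

  Code↔ : Code ↔ Fin (length C + q)
  Code↔ = ↔-sym FP.+↔⊎

  decode : Code → Word q (suc n)
  decode (inj₁ i) = proj₁ (sound (∈-lookup i))
  decode (inj₂ x) = V.replicate (suc n) x

  decode-injective : Injective _≡_ _≡_ decode
  decode-injective {inj₁ i} {inj₁ j} eq = cong inj₁ (lookup-injective unique (begin
    L.lookup C i                      ≡⟨ proj₁ (proj₂ (sound (∈-lookup i))) ⟩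
    toList (decode (inj₁ i))          ≡⟨ cong toList eq ⟩
    toList (decode (inj₁ j))          ≡⟨ proj₁ (proj₂ (sound (∈-lookup j))) ⟨
    L.lookup C j                      ∎))
    where open ≡-Reasoning
  decode-injective {inj₁ i} {inj₂ x} eq =
    ⊥-elim (proj₂ (proj₂ (sound (∈-lookup i))) (subst Constant (sym eq) (replicate-Constant _ x)))
  decode-injective {inj₂ x} {inj₁ j} eq =
    ⊥-elim (proj₂ (proj₂ (sound (∈-lookup j))) (subst Constant eq (replicate-Constant _ x)))
  decode-injective {inj₂ x} {inj₂ y} eq = cong inj₂ (cong V.head eq)

  encodeWith : (w : Word q (suc n)) → Dec (Constant w) → Code
  encodeWith w (yes _)           = inj₂ (V.head w)
  encodeWith w (no nonconstant) = inj₁ (Any.index (complete w nonconstant))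

  encodeWith-injective : ∀ {w w′} d d′ → encodeWith w d ≡ encodeWith w′ d′ → w ≡ w′
  encodeWith-injective {w} {w′} (yes constant) (yes constant′) eq = begin
    w                                ≡⟨ Constant⇒replicate w constant ⟩
    V.replicate (suc n) (V.head w)   ≡⟨ cong (V.replicate (suc n)) (inj₂-injective eq) ⟩
    V.replicate (suc n) (V.head w′)  ≡⟨ Constant⇒replicate w′ constant′ ⟨
    w′                               ∎
    where open ≡-Reasoning
  encodeWith-injective (no nonconstant) (no nonconstant′) eq = toList-injective
    (index-injective (≡.setoid _) (complete _ nonconstant) (complete _ nonconstant′) (inj₁-injective eq))

  encode-injective : Injective _≡_ _≡_ (λ w → encodeWith w (VP.≡-dec FP._≟_ (rot w) w))
  encode-injective = encodeWith-injective _ _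

Valid⇒n*k≤q^ℓ : ∀ {q k ℓ n} → ℓ ≤ k → (ws : Vec (Word q k) n) → Valid ℓ ws → n * k ≤ q ^ ℓ
Valid⇒n*k≤q^ℓ {q} {k} {ℓ} {n} ℓ≤k ws valid =
  injection⇒≤ (↔-sym FP.*↔×) (Vec↔Fin^ q ℓ) (mk↣ windowAt-injective)
  where
  length-window : ∀ i (w : Word q k) → length (window ℓ i w) ≡ ℓ
  length-window i w = trans (LP.length-take ℓ (toList (rotN i w)))
    (trans (cong (ℓ ⊓_) (VP.length-toList (rotN i w))) (m≤n⇒m⊓n≡m ℓ≤k))

  windowAt : Fin n × Fin k → Word q ℓ
  windowAt (j , i) = fromList′ _ (length-window (Fin.toℕ i) (V.lookup ws j))

  toList-windowAt : ∀ j i → toList (windowAt (j , i)) ≡ window ℓ (Fin.toℕ i) (V.lookup ws j)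
  toList-windowAt j i = toList-fromList′ _ (length-window (Fin.toℕ i) (V.lookup ws j))

  windowAt-injective : Injective _≡_ _≡_ windowAt
  windowAt-injective {j , i} {j′ , i′} eq
    with valid j j′ i i′
           (trans (sym (toList-windowAt j i)) (trans (cong toList eq) (toList-windowAt j′ i′)))
  ... | refl , refl = refl

module Components {m : ℕ} (F : Fin m → Fin m → Set) where

  open import Data.List.Membership.DecPropositional (FP._≟_ {m}) using (_∈?_)

  exitEdge : ∀ {S x u} → x ∈ S → Star F x u → u ∉ S → ∃[ s ] ∃[ v ] (s ∈ S × v ∉ S × F s v)
  exitEdge x∈S ε                  u∉S = ⊥-elim (u∉S x∈S)
  exitEdge {S} x∈S (_◅_ {j = y} e path) u∉S with y ∈? S
  ... | yes y∈S = exitEdge y∈S path u∉S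
  ... | no  y∉S = _ , y , x∈S , y∉S , e

  module Growth (Q : List (Fin m) → Set) (Q-[_] : ∀ r → Q [ r ])
                (Q-∷ : ∀ {S s v} → s ∈ S → F s v → Q S → Q (v ∷ S)) where

    record Connected (r : Fin m) : Set where
      field
        vertices  : List (Fin m)
        unique    : Unique vertices
        root      : r ∈ vertices
        reachable : ∀ {v} → v ∈ vertices → Star F r v
        property  : Q vertices
    open Connected

    extend : ∀ {r} (C : Connected r) {s v} → s ∈ vertices C → v ∉ vertices C → F s v → Connected r
    extend C s∈ v∉ e = record
      { vertices  = _ ∷ vertices C
      ; unique    = All.tabulate (λ { w∈ refl → v∉ w∈ }) ∷ unique C
      ; root      = there (root C)
      ; reachable = λ { (here refl) → reachable C s∈ ◅◅ (e ◅ ε) ; (there w∈) → reachable C w∈ }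
      ; property  = Q-∷ s∈ e (property C)
      }

    module _ {r : Fin m} (xs : List (Fin m)) (xs-unique : Unique xs)
             (xs-component : ∀ v → v ∈ xs ⇔ Star F r v) where

      grow : ∀ fuel (C : Connected r) → length (vertices C) + fuel ≡ length xs →
             Σ (Connected r) λ C′ → ∀ {v} → v ∈ xs → v ∈ vertices C′
      grow fuel C size with All.all? (_∈? vertices C) xs
      ... | yes xs⊆C = C , All.lookup xs⊆C
      ... | no  xs⊈C with find (¬All⇒Any¬ (_∈? vertices C) xs xs⊈C)
      ...   | u , u∈xs , u∉C with exitEdge (root C) (Equivalence.to (xs-component u) u∈xs) u∉C
      ...     | s , v , s∈C , v∉C , e with fuel
      ...       | suc fuel′ = grow fuel′ (extend C s∈C v∉C e)
                                (trans (sym (+-suc (length (vertices C)) fuel′)) size)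
      ...       | zero      = ⊥-elim (<-irrefl refl (begin-strict
        length xs                   ≡⟨ size ⟨
        length (vertices C) + 0     ≡⟨ +-identityʳ _ ⟩
        length (vertices C)         <⟨ n<1+n _ ⟩
        length (vertices C′)        ≤⟨ Unique-⊆⇒length≤ (unique C′) (λ w∈ → Equivalence.from
                                         (xs-component _) (reachable C′ w∈)) ⟩
        length xs                   ∎))
        where
        open ≤-Reasoning
        C′ = extend C s∈C v∉C e

    component : ∀ {t} r → ComponentSize F r t →
                ∃[ S ] (Unique S × length S ≡ t × (∀ v → v ∈ S ⇔ Star F r v) × Q S)
    component r (xs , |xs|≡t , xs-unique , xs-component) =
      vertices C , unique C , trans |S|≡|xs| |xs|≡t ,
      (λ v → mk⇔ (reachable C) (λ path → xs⊆S (Equivalence.from (xs-component v) path))) ,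
      property C
      where
      start : Connected r
      start = record { vertices = [ r ] ; unique = [] ∷ [] ; root = here refl
                     ; reachable = λ { (here refl) → ε } ; property = Q-[ r ] }
      r∈xs : r ∈ xs
      r∈xs = Equivalence.from (xs-component r) ε
      grown = grow xs xs-unique xs-component (length xs ∸ 1) start
                (m+[n∸m]≡n (Unique-⊆⇒length≤ (unique start) λ { (here refl) → r∈xs }))
      C = proj₁ grown
      xs⊆S = proj₂ grown
      |S|≡|xs| : length (vertices C) ≡ length xs
      |S|≡|xs| = ≤-antisym
        (Unique-⊆⇒length≤ (unique C) (λ v∈ → Equivalence.from (xs-component _) (reachable C v∈)))
        (Unique-⊆⇒length≤ xs-unique xs⊆S)

  module Partitions (F-sym : ∀ {u v} → F u v → F v u) (P : List (Fin m) → Set)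
                    (component : ∀ r → ∃[ S ] (Unique S × (∀ v → v ∈ S ⇔ Star F r v) × P S)) where

    record Partition (vs : List (Fin m)) : Set where
      field
        parts    : List (∃ P)
        unique   : Unique (concatMap proj₁ parts)
        closed   : ∀ {u v} → u ∈ concatMap proj₁ parts → Star F u v → v ∈ concatMap proj₁ parts
        covering : ∀ {v} → v ∈ vs → v ∈ concatMap proj₁ parts
    open Partition

    partition : ∀ vs → Partition vs
    partition []       = record { parts = [] ; unique = [] ; closed = λ () ; covering = λ () }
    partition (v ∷ vs) with partition vs
    ... | Π with v ∈? concatMap proj₁ (parts Π)
    ...   | yes v∈Π = record
      { parts    = parts Π
      ; unique   = unique Π
      ; closed   = closed Π
      ; covering = λ { (here refl) → v∈Π ; (there w∈) → covering Π w∈ }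
      }
    ...   | no  v∉Π with component v
    ...     | S , S-unique , S-component , PS = record
      { parts    = (S , PS) ∷ parts Π
      ; unique   = UP.++⁺ S-unique (unique Π) disjoint
      ; closed   = λ u∈ path → case ∈-++⁻ S u∈ of λ
          { (inj₁ u∈S) → ∈-++⁺ˡ (from-S (to-S u∈S ◅◅ path))
          ; (inj₂ u∈Π) → ∈-++⁺ʳ S (closed Π u∈Π path) }
      ; covering = λ { (here refl) → ∈-++⁺ˡ (from-S ε) ; (there w∈) → ∈-++⁺ʳ S (covering Π w∈) }
      }
      where
      to-S : ∀ {w} → w ∈ S → Star F v w
      to-S = Equivalence.to (S-component _)
      from-S : ∀ {w} → Star F v w → w ∈ S
      from-S = Equivalence.from (S-component _)
      disjoint : Disjoint S (concatMap proj₁ (parts Π))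
      disjoint (w∈S , w∈Π) = v∉Π (closed Π w∈Π (reverse F-sym (to-S w∈S)))

module Gluing {q ℓ m : ℕ} (reps : Vec (Word q ℓ) m) where

  necklace : Fin m → List (Fin q)
  necklace v = toList (V.lookup reps v)

  length-necklace : ∀ v → length (necklace v) ≡ ℓ
  length-necklace v = VP.length-toList (V.lookup reps v)

  necklace-nonempty : 0 < ℓ → ∀ v → 0 < length (necklace v)
  necklace-nonempty 0<ℓ v = subst (0 <_) (sym (length-necklace v)) 0<ℓ

  necklaceWindows : List (Fin m) → List (List (Fin q))
  necklaceWindows = concatMap (windows ℓ ∘ necklace)

  length-necklaceWindows : ∀ S → length (necklaceWindows S) ≡ length S * ℓ
  length-necklaceWindows []      = refl
  length-necklaceWindows (v ∷ S) = trans (LP.length-++ (windows ℓ (necklace v)))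
    (cong₂ _+_ (trans (length-windows ℓ (necklace v)) (length-necklace v)) (length-necklaceWindows S))

  ∈-necklaceWindows⁺ : ∀ S {v x} → v ∈ S → x ∈ windows ℓ (necklace v) → x ∈ necklaceWindows S
  ∈-necklaceWindows⁺ S v∈S x∈ = ∈-concatMap⁺ (windows ℓ ∘ necklace) (lose v∈S x∈)

  ∈-necklaceWindows⁻ : ∀ S {x} → x ∈ necklaceWindows S → ∃[ v ] (v ∈ S × x ∈ windows ℓ (necklace v))
  ∈-necklaceWindows⁻ S x∈ = find (∈-concatMap⁻ (windows ℓ ∘ necklace) x∈)

  Glueable : List (Fin m) → Set
  Glueable S = ∃[ W ] (ℓ ≤ length W × windows ℓ W ↭ necklaceWindows S)

  glueable-[_] : ∀ r → Glueable [ r ]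
  glueable-[ r ] = necklace r , ≤-reflexive (sym (length-necklace r)) ,
                   ↭-reflexive (sym (LP.++-identityʳ _))

  sharedFactor⇒rotation : ∀ {x u : Word q ℓ} {f} → SameNecklace x u → IsFactor (ℓ ∸ 1) f u →
                          ∃[ c ] take (ℓ ∸ 1) (lrotN c (toList x)) ≡ f
  sharedFactor⇒rotation {x} (a , refl) (i , f≡) = a + i , (begin
    take (ℓ ∸ 1) (lrotN (a + i) (toList x))          ≡⟨ cong (take (ℓ ∸ 1)) (lrotN-+ a i (toList x)) ⟩
    take (ℓ ∸ 1) (lrotN i (lrotN a (toList x)))      ≡⟨ cong (take (ℓ ∸ 1) ∘ lrotN i) (toList-rotN a x) ⟨
    take (ℓ ∸ 1) (lrotN i (toList (rotN a x)))       ≡⟨ cong (take (ℓ ∸ 1)) (toList-rotN i (rotN a x)) ⟨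
    window (ℓ ∸ 1) i (rotN a x)                      ≡⟨ f≡ ⟩
    _                                                ∎)
    where open ≡-Reasoning

  -- Rotate W so that it starts with the shared factor f of s and v, rotate v likewise, and concatenate.
  glueable-∷ : 0 < ℓ → ∀ {S s v} → s ∈ S → N'Adj reps s v → Glueable S → Glueable (v ∷ S)
  glueable-∷ 0<ℓ {S} {s} {v} s∈S (_ , _ , _ , s~u , v~u′ , f , f⊑u , f⊑u′) (W , ℓ≤W , W↭S) =
    V₁ ++ W₁ , ≤-trans ℓ≤W₁ (LP.length-++-≤ʳ W₁ {V₁}) ,
    ↭-trans (↭-reflexive (windows-++ ℓ V₁ W₁ ℓ≤V₁ ℓ≤W₁ (trans V₁-prefix (sym W₁-prefix))))
            (++⁺ (windows-lrotN ℓ c₂ (necklace v)) (↭-trans (windows-lrotN ℓ p W) W↭S))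
    where
    c₁ = proj₁ (sharedFactor⇒rotation s~u f⊑u)
    c₂ = proj₁ (sharedFactor⇒rotation v~u′ f⊑u′)
    V₁ = lrotN c₂ (necklace v)
    V₁-prefix : take (ℓ ∸ 1) V₁ ≡ f
    V₁-prefix = proj₂ (sharedFactor⇒rotation v~u′ f⊑u′)
    ℓ≤V₁ : ℓ ≤ length V₁
    ℓ≤V₁ = ≤-reflexive (sym (trans (length-lrotN c₂ (necklace v)) (length-necklace v)))
    window∈W : lwindow ℓ c₁ (necklace s) ∈ windows ℓ W
    window∈W = ∈-resp-↭ (↭-sym W↭S) (∈-necklaceWindows⁺ S s∈S
      (lwindow-∈-windows ℓ c₁ (necklace s) (necklace-nonempty 0<ℓ s)))
    p = proj₁ (∈-applyUpTo⁻ _ window∈W)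
    p-window : lwindow ℓ c₁ (necklace s) ≡ lwindow ℓ p W
    p-window = proj₂ (proj₂ (∈-applyUpTo⁻ _ window∈W))
    W₁ = lrotN p W
    ℓ≤W₁ : ℓ ≤ length W₁
    ℓ≤W₁ = subst (ℓ ≤_) (sym (length-lrotN p W)) ℓ≤W
    W₁-prefix : take (ℓ ∸ 1) W₁ ≡ f
    W₁-prefix = begin
      take (ℓ ∸ 1) W₁                          ≡⟨ take-take-≤ W₁ (m∸n≤m ℓ 1) ⟨
      take (ℓ ∸ 1) (lwindow ℓ p W)             ≡⟨ cong (take (ℓ ∸ 1)) p-window ⟨
      take (ℓ ∸ 1) (lwindow ℓ c₁ (necklace s)) ≡⟨ take-take-≤ _ (m∸n≤m ℓ 1) ⟩
      take (ℓ ∸ 1) (lrotN c₁ (necklace s))     ≡⟨ proj₂ (sharedFactor⇒rotation s~u f⊑u) ⟩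
      f                                        ∎
      where open ≡-Reasoning

  wordOf : ∀ {t} S → length S ≡ t → Glueable S →
           Σ (Word q (t * ℓ)) λ W → windows ℓ (toList W) ↭ necklaceWindows S
  wordOf {t} S |S|≡t (W , _ , W↭S) =
    fromList′ W |W|≡tℓ ,
    subst (λ w → windows ℓ w ↭ necklaceWindows S) (sym (toList-fromList′ W |W|≡tℓ)) W↭S
    where
    |W|≡tℓ : length W ≡ t * ℓ
    |W|≡tℓ = begin
      length W                     ≡⟨ length-windows ℓ W ⟨
      length (windows ℓ W)         ≡⟨ ↭-length W↭S ⟩
      length (necklaceWindows S)   ≡⟨ length-necklaceWindows S ⟩
      length S * ℓ                 ≡⟨ cong (_* ℓ) |S|≡t ⟩
      t * ℓ                        ∎
      where open ≡-Reasoning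

module Enumerated {q n m : ℕ} (reps : Vec (Word q (suc (suc n))) m) (enum : NecklaceEnum reps) where

  open Gluing reps
  open NecklaceEnum enum

  private
    ℓ = suc (suc n)

  necklaceWindows-unique : ∀ {S} → Unique S → Unique (necklaceWindows S)
  necklaceWindows-unique {[]}    []               = []
  necklaceWindows-unique {v ∷ S} (v∉S ∷ S-unique) =
    UP.++⁺ (Aperiodic⇒Unique-windows _ (aperiodic v)) (necklaceWindows-unique S-unique) disjoint
    where
    disjoint : Disjoint (windows ℓ (necklace v)) (necklaceWindows S)
    disjoint (x∈v , x∈S) with ∈-necklaceWindows⁻ S x∈S
    ... | v′ , v′∈S , x∈v′ with ∈-windows-toList⁻ _ x∈v | ∈-windows-toList⁻ _ x∈v′
    ... | c , refl | c′ , eq =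
      All.lookup v∉S v′∈S (distinct v v′ (rotN≡⇒SameNecklace c c′ _ _ (toList-injective eq)))

  necklaceWindow-nonConstant : ∀ S {x} → x ∈ necklaceWindows S →
                               Σ (Word q ℓ) λ w → x ≡ toList w × ¬ Constant w
  necklaceWindow-nonConstant S x∈S with ∈-necklaceWindows⁻ S x∈S
  ... | v , _ , x∈v with ∈-windows-toList⁻ _ x∈v
  ... | c , refl = rotN c (V.lookup reps v) , refl ,
    λ constant → Aperiodic⇒¬Constant _ (aperiodic v) (Constant-rotN⁻ c _ constant)

  nonConstant-necklaceWindow : Prime ℓ → (w : Word q ℓ) → ¬ Constant w →
                               ∃[ v ] toList w ∈ windows ℓ (necklace v)
  nonConstant-necklaceWindow ℓ-prime w nonconstant
    with complete w (¬Constant⇒Aperiodic ℓ-prime w nonconstant)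
  ... | v , c , refl = v , subst (_∈ windows ℓ (necklace v)) (lwindow-toList c (V.lookup reps v))
                              (lwindow-∈-windows ℓ c (necklace v) (necklace-nonempty (s≤s z≤n) v))

module Colourings {q k : ℕ} (ℓ : ℕ) where

  colouringWindows : List (Word q k) → List (List (Fin q))
  colouringWindows = concatMap (windows ℓ ∘ toList)

  length-colouringWindows : ∀ ws → length (colouringWindows ws) ≡ length ws * k
  length-colouringWindows []       = refl
  length-colouringWindows (w ∷ ws) = trans (LP.length-++ (windows ℓ (toList w)))
    (cong₂ _+_ (trans (length-windows ℓ (toList w)) (VP.length-toList w)) (length-colouringWindows ws))

  toℕ<length : (w : Word q k) (i : Fin k) → Fin.toℕ i < length (toList w)
  toℕ<length w i = subst (Fin.toℕ i <_) (sym (VP.length-toList w)) (FP.toℕ<n i)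

  window∈windows : (w : Word q k) (i : Fin k) → window ℓ (Fin.toℕ i) w ∈ windows ℓ (toList w)
  window∈windows w i = subst (_∈ windows ℓ (toList w)) (sym (window≡lwindow ℓ (Fin.toℕ i) w))
    (∈-applyUpTo⁺ _ (toℕ<length w i))

  window∈colouringWindows : ∀ ws j (i : Fin k) →
    window ℓ (Fin.toℕ i) (V.lookup (V.fromList ws) j) ∈ colouringWindows ws
  window∈colouringWindows (w ∷ ws) Fin.zero    i = ∈-++⁺ˡ (window∈windows w i)
  window∈colouringWindows (w ∷ ws) (Fin.suc j) i = ∈-++⁺ʳ _ (window∈colouringWindows ws j i)

  Unique⇒Valid : ∀ ws → Unique (colouringWindows ws) → Valid ℓ (V.fromList ws)
  Unique⇒Valid (w ∷ ws) unique j j′ i i′ eq with Unique-++⁻ (windows ℓ (toList w)) unique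
  Unique⇒Valid (w ∷ ws) _ Fin.zero Fin.zero i i′ eq | w-unique , _ , _ =
    refl , FP.toℕ-injective (applyUpTo-injective _ w-unique (toℕ<length w i) (toℕ<length w i′)
      (trans (sym (window≡lwindow ℓ (Fin.toℕ i) w)) (trans eq (window≡lwindow ℓ (Fin.toℕ i′) w))))
  Unique⇒Valid (w ∷ ws) _ Fin.zero (Fin.suc j′) i i′ eq | _ , _ , disjoint =
    ⊥-elim (disjoint (window∈windows w i , subst (_∈ _) (sym eq) (window∈colouringWindows ws j′ i′)))
  Unique⇒Valid (w ∷ ws) _ (Fin.suc j) Fin.zero i i′ eq | _ , _ , disjoint =
    ⊥-elim (disjoint (window∈windows w i′ , subst (_∈ _) eq (window∈colouringWindows ws j i)))
  Unique⇒Valid (w ∷ ws) _ (Fin.suc j) (Fin.suc j′) i i′ eq | _ , ws-unique , _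
    with Unique⇒Valid ws ws-unique j j′ i i′ eq
  ... | refl , i≡i′ = refl , i≡i′

module Construction {q n m t : ℕ} (reps : Vec (Word q (suc (suc n))) m) (enum : NecklaceEnum reps)
                    (forest : SpanningForestOfSize (N'Adj reps) t) where

  private
    ℓ = suc (suc n)
    k = t * ℓ

  open Gluing reps
  open Enumerated reps enum
  open SpanningForestOfSize forest
  open Components F
  open Colourings {q} {k} ℓ

  BugFor : List (Fin m) → Set
  BugFor S = Σ (Word q k) λ W → windows ℓ (toList W) ↭ necklaceWindows S

  open Growth Glueable glueable-[_] (λ s∈S e → glueable-∷ (s≤s z≤n) s∈S (subgraph _ _ e))

  tree : ∀ r → ∃[ S ] (Unique S × (∀ v → v ∈ S ⇔ Star F r v) × BugFor S)
  tree r with component r (treeSizes r)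
  ... | S , S-unique , |S|≡t , S-tree , glueable = S , S-unique , S-tree , wordOf S |S|≡t glueable

  open Partitions (λ {u} {v} → symmetric u v) BugFor tree
  open Partition (partition (L.allFin m))

  bugOf : ∃ BugFor → Word q k
  bugOf (_ , W , _) = W

  bugs : List (Word q k)
  bugs = L.map bugOf parts

  colouringWindows-↭ : ∀ ps → colouringWindows (L.map bugOf ps) ↭ necklaceWindows (concatMap proj₁ ps)
  colouringWindows-↭ []                    = ↭-refl
  colouringWindows-↭ ((S , W , W↭S) ∷ ps) = ↭-trans (++⁺ W↭S (colouringWindows-↭ ps))
    (↭-reflexive (sym (LP.concatMap-++ (windows ℓ ∘ necklace) S (concatMap proj₁ ps))))

  bugs-unique : Unique (colouringWindows bugs)
  bugs-unique = Unique-resp-↭ (↭-sym (colouringWindows-↭ parts)) (necklaceWindows-unique unique)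

  bugs-tile : Prime ℓ → length bugs * k + q ≡ q ^ ℓ
  bugs-tile ℓ-prime = trans (cong (_+ q) (sym (length-colouringWindows bugs)))
    (length≡#nonConstant (colouringWindows bugs) bugs-unique
      (λ x∈ → necklaceWindow-nonConstant (concatMap proj₁ parts)
                (∈-resp-↭ (colouringWindows-↭ parts) x∈))
      (λ w nonconstant → let v , w∈v = nonConstant-necklaceWindow ℓ-prime w nonconstant in
        ∈-resp-↭ (↭-sym (colouringWindows-↭ parts)) (∈-necklaceWindows⁺ _ (covering (∈-allFin v)) w∈v)))

  bugs-valid : Valid ℓ (V.fromList bugs)
  bugs-valid = Unique⇒Valid bugs bugs-unique

perfectColouring : ∀ {q ℓ m t} (reps : Vec (Word q ℓ) m) → Prime ℓ → NecklaceEnum reps →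
  SpanningForestOfSize (N'Adj reps) t →
  ∃[ N ] Σ (Vec (Word q (t * ℓ)) N) λ ws → Valid ℓ ws × N * (t * ℓ) + q ≡ q ^ ℓ
perfectColouring {ℓ = 0}           _    0-prime = ⊥-elim (¬prime[0] 0-prime)
perfectColouring {ℓ = 1}           _    1-prime = ⊥-elim (¬prime[1] 1-prime)
perfectColouring {ℓ = suc (suc _)} reps ℓ-prime enum forest =
  length bugs , V.fromList bugs , bugs-valid , bugs-tile ℓ-prime
  where open Construction reps enum forest

m*k≤n*k+r⇒m≤n : ∀ {m n k r} → r < k → m * k ≤ n * k + r → m ≤ n
m*k≤n*k+r⇒m≤n {m} {n} {k} {r} r<k mk≤nk+r = s≤s⁻¹ (*-cancelʳ-< k m (suc n) (begin-strict
  m * k      ≤⟨ mk≤nk+r ⟩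
  n * k + r  <⟨ +-monoʳ-< (n * k) r<k ⟩
  n * k + k  ≡⟨ +-comm (n * k) k ⟩
  suc n * k  ∎))
  where open ≤-Reasoning

optimum-bounds : ∀ {N E k q Q} → N * k + q ≡ Q → N ≤ E → E * k ≤ Q →
                 (Q ∸ q ≤ E * k) × (q < k → E * k ≡ Q ∸ q)
optimum-bounds {N} {E} {k} {q} refl N≤E Ek≤Q =
  subst (_≤ E * k) (sym Q∸q≡Nk) (*-monoˡ-≤ k N≤E) ,
  λ q<k → trans (cong (_* k) (≤-antisym (m*k≤n*k+r⇒m≤n q<k Ek≤Q) N≤E)) (sym Q∸q≡Nk)
  where
  Q∸q≡Nk : N * k + q ∸ q ≡ N * k
  Q∸q≡Nk = m+n∸n≡m (N * k) q

proposition3 : ∀ (ℓ q t : ℕ) → Prime ℓ → 1 ≤ q → 1 ≤ t →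
    ∀ (m : ℕ) (reps : Vec (Word q ℓ) m) → NecklaceEnum reps →
    SpanningForestOfSize (N'Adj reps) t →
    ∀ (E : ℕ) → Is𝓔 q (t * ℓ) ℓ E →
    (q ^ ℓ ∸ q ≤ E * (t * ℓ)) × (q < t * ℓ → E * (t * ℓ) ≡ q ^ ℓ ∸ q)
proposition3 ℓ q t ℓ-prime _ 1≤t m reps enum forest E ((ws , ws-valid) , maximal) =
  let N , bugs , bugs-valid , N-tiles = perfectColouring reps ℓ-prime enum forest in
  optimum-bounds N-tiles (maximal N bugs bugs-valid) (Valid⇒n*k≤q^ℓ ℓ≤tℓ ws ws-valid)
  where
  ℓ≤tℓ : ℓ ≤ t * ℓ
  ℓ≤tℓ = subst (_≤ t * ℓ) (+-identityʳ ℓ) (*-monoˡ-≤ ℓ 1≤t)
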